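{- Let $G$ be a finite connected graph with diameter $d$ and radius $r$. Then $\mathrm{mp}(G)\geq \frac{d}{6}+\frac{r}{3}-\frac{3}{2}$.
   Context: For a graph $G=(V,E)$, the ball of radius $r$ around $v$ is $N_r(v)=\{u\in V : d_G(u,v)\leq r\}$. A multipacking of $G$ is a set $P\subseteq V$ such that for every vertex $v$ and every positive integer $r$, $|N_r(v)\cap P|\leq r$. The multipacking number $\mathrm{mp}(G)$ is the maximum size of a multipacking of $G$. -}

module Defs where

open import Data.Nat using (ℕ; zero; suc; _≤_; _<_)
open import Data.Bool using (Bool; true; false; _∧_; _∨_)
open import Data.Fin using (Fin; _≟_)
open import Data.Fin.Subset using (Subset; _∩_; ∣_∣)
open import Data.List using (allFin)
open import Data.Bool.ListAction using (any)
open import Data.Vec using (tabulate)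
open import Data.Product using (_×_; Σ; ∃; ∃-syntax)
open import Relation.Nullary.Decidable using (⌊_⌋)
open import Relation.Binary.PropositionalEquality using (_≡_)

record Graph (n : ℕ) : Set where
  field
    adj    : Fin n → Fin n → Bool
    sym    : ∀ u v → adj u v ≡ adj v u
    irrefl : ∀ v → adj v v ≡ false
open Graph public

module _ {n : ℕ} (G : Graph n) where

  -- reach k u v = true  iff  d_G(u,v) ≤ k  (there is a walk of length ≤ k)
  reach : ℕ → Fin n → Fin n → Bool
  reach zero    u v = ⌊ u ≟ v ⌋
  reach (suc k) u v = reach k u v ∨ any (λ w → reach k u w ∧ adj G w v) (allFin n)

  IsDist : Fin n → Fin n → ℕ → Set
  IsDist u v k = (reach k u v ≡ true) × (∀ j → j < k → reach j u v ≡ false)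

  Connected : Set
  Connected = ∀ u v → ∃[ k ] reach k u v ≡ true

  IsDiameter : ℕ → Set
  IsDiameter d = (∀ u v → reach d u v ≡ true) × ∃[ u ] ∃[ v ] IsDist u v d

  EccAtMost : Fin n → ℕ → Set
  EccAtMost v e = ∀ u → reach e v u ≡ true

  IsRadius : ℕ → Set
  IsRadius r = (∃[ v ] EccAtMost v r) × (∀ v j → j < r → ∃[ u ] reach j v u ≡ false)

  ball : ℕ → Fin n → Subset n
  ball r v = tabulate (λ u → reach r v u)

  IsMultipacking : Subset n → Set
  IsMultipacking P = ∀ v r → 1 ≤ r → ∣ ball r v ∩ P ∣ ≤ r

  IsMultipackingNumber : ℕ → Set
  IsMultipackingNumber m =
    (∃[ P ] (IsMultipacking P × ∣ P ∣ ≡ m)) × (∀ P → IsMultipacking P → ∣ P ∣ ≤ m)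

module Submission where

-- Let u = p 0, …, p d be a diametral geodesic with midpoint c = p h, h = ⌈d/2⌉, and let q be a
-- geodesic from c to a vertex w with d(c, w) = ℓ ≥ r, which exists because no vertex has
-- eccentricity below r.  The multipacking is the tripod
--   S = { p i : i = 0, 3, 6, … ≤ d } ∪ { q j : j = h + 6, h + 9, … ≤ ℓ },
-- of size about (d + 1)/3 + (ℓ − h − 5)/3, which is exactly what d + 2r ≤ 6|S| + 9 needs.
-- Points of S in a ball of radius k are at mutual distance ≤ 2k; along each geodesic distances
-- are index differences, and across, d(c, q j) = j ≤ d(c, p i) + 2k with d(c, p i) = |i − h|.
-- Hence the ball holds at most (2k + 3)/3 points of the path and as many of the branch.  Splitting
-- the path at c into two arms, an arm together with the branch holds at most 2k/3 points, because
-- the branch starts 6 beyond the arm's reach from c.  For k ≥ 1 these pair bounds leave room for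
-- at most k points in all.

open import Defs hiding (sym)
open import Data.Bool using (T; false)
open import Data.Bool.Properties using (T-∨; T-∧; T-≡)
open import Data.Empty using (⊥-elim)
open import Data.Fin using (Fin)
open import Data.Fin.Subset using (Subset; ⁅_⁆; _∪_; _∩_; _-_; ⊥; ∣_∣; _⊆_; inside; outside) renaming (_∈_ to _∈ₛ_)
open import Data.Fin.Subset.Properties
  using (_∈?_; x∈p∪q⁺; x∈p∪q⁻; x∈p∩q⁻; x∈⁅x⁆; x∈⁅y⁆⇒x≡y; ∉⊥; ∣⊥∣≡0; ∣⁅x⁆∣≡1; p⊆q⇒∣p∣≤∣q∣; p⊂q⇒∣p∣<∣q∣; x∈p⇒p-x⊂p; x∈p∧x≢y⇒x∈p-y)
open import Data.List using (List; []; _∷_; _++_; length; map; filter; foldr; allFin)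
open import Data.List.Properties using (length-++; length-map; filter-++)
open import Data.List.Extrema.Nat using (max; ⊥≤max; xs≤max; argmax-sel)
open import Data.List.Membership.Propositional using (_∈_)
open import Data.List.Membership.Propositional.Properties using (∈-filter⁺; ∈-filter⁻; ∈-allFin)
open import Data.List.Relation.Unary.All as All using (All; []; _∷_)
import Data.List.Relation.Unary.All.Properties as All
open import Data.List.Relation.Unary.AllPairs as AllPairs using (AllPairs; []; _∷_)
import Data.List.Relation.Unary.AllPairs.Properties as AllPairs
open import Data.List.Relation.Unary.Any as Any using (here; there; satisfied)
open import Data.List.Relation.Unary.Any.Properties using (any⁺; any⁻)
open import Data.List.Relation.Unary.Unique.Propositional using (Unique)
open import Data.Nat using (ℕ; zero; suc; _+_; _*_; _≤_; _<_; _≤′_; _≤?_; _<?_; z≤n; s≤s; z<s; ≤′-refl; ≤′-step)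
open import Data.Nat.Properties
open import Data.Nat.Tactic.RingSolver using (solve-∀)
open import Data.Product using (_×_; _,_; proj₁; proj₂; ∃-syntax)
open import Data.Sum using (_⊎_; inj₁; inj₂; [_,_]′)
import Data.Vec as Vec
open import Data.Vec.Properties using (lookup∘tabulate; []=⇒lookup)
open import Function using (id; _∘_)
open import Function.Bundles using (Equivalence)
open import Level using (0ℓ)
open import Relation.Binary.PropositionalEquality
open import Relation.Nullary using (¬_; yes; no)
open import Relation.Nullary.Decidable using (¬?; T?; toWitness; fromWitness)
open import Relation.Unary using (Pred; Decidable)

Spaced : List ℕ → Set
Spaced = AllPairs (λ a b → a + 3 ≤ b)

progression : ℕ → ℕ → List ℕ
progression s zero    = []
progression s (suc n) = s ∷ progression (s + 3) n

length-progression : ∀ s n → length (progression s n) ≡ n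
length-progression s zero    = refl
length-progression s (suc n) = cong suc (length-progression (s + 3) n)

progression-≥ : ∀ s n → All (s ≤_) (progression s n)
progression-≥ s zero    = []
progression-≥ s (suc n) = ≤-refl ∷ All.map (≤-trans (m≤m+n s 3)) (progression-≥ (s + 3) n)

progression-spaced : ∀ s n → Spaced (progression s n)
progression-spaced s zero    = []
progression-spaced s (suc n) = progression-≥ (s + 3) n ∷ progression-spaced (s + 3) n

progression-covering : ∀ s m → ∃[ n ] All (_≤ m) (progression s n) × m < s + 3 * n
progression-covering s m with s ≤? m
... | yes s≤m with o , refl ← m≤n⇒∃[o]m+o≡n s≤m = covering s o
  where
  covering : ∀ s o → ∃[ n ] All (_≤ s + o) (progression s n) × s + o < s + 3 * n
  covering s 0 = 1 , m≤m+n s 0 ∷ [] , +-monoʳ-< s (s≤s z≤n)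
  covering s 1 = 1 , m≤m+n s 1 ∷ [] , +-monoʳ-< s (s≤s (s≤s z≤n))
  covering s 2 = 1 , m≤m+n s 2 ∷ [] , +-monoʳ-< s (s≤s (s≤s (s≤s z≤n)))
  covering s (suc (suc (suc o))) with covering (s + 3) o
  ... | n , below , covered =
    suc n , m≤m+n s _ ∷ subst (λ m → All (_≤ m) (progression (s + 3) n)) (+-assoc s 3 o) below
          , subst₂ _<_ (+-assoc s 3 o) (trans (+-assoc s 3 (3 * n)) (cong (s +_) (sym (*-suc 3 n)))) covered
... | no s≰m = 0 , [] , subst (m <_) (sym (+-identityʳ s)) (≰⇒> s≰m)

spaced-head-minimal : ∀ {x xs} → Spaced (x ∷ xs) → All (x ≤_) (x ∷ xs)
spaced-head-minimal (x+3≤xs ∷ _) = ≤-refl ∷ All.map (≤-trans (m≤m+n _ 3)) x+3≤xs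

spaced-length : ∀ {lo hi xs} → lo ≤ hi + 3 → Spaced xs → All (λ y → lo ≤ y × y ≤ hi) xs →
                3 * length xs + lo ≤ hi + 3
spaced-length lo≤hi+3 [] [] = lo≤hi+3
spaced-length {lo} {hi} {x ∷ xs} _ (x+3≤xs ∷ spaced) ((lo≤x , x≤hi) ∷ window) = begin
  3 * suc (length xs) + lo  ≡⟨ cong (_+ lo) (*-suc 3 (length xs)) ⟩
  3 + 3 * length xs + lo    ≤⟨ +-monoʳ-≤ (3 + 3 * length xs) lo≤x ⟩
  3 + 3 * length xs + x     ≡⟨ shuffle (length xs) x ⟩
  3 * length xs + (x + 3)   ≤⟨ spaced-length (+-monoˡ-≤ 3 x≤hi) spaced (All.zip (x+3≤xs , All.map proj₂ window)) ⟩
  hi + 3                    ∎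
  where
  open ≤-Reasoning
  shuffle : ∀ a x → 3 + 3 * a + x ≡ 3 * a + (x + 3)
  shuffle = solve-∀

spread-length : ∀ {D xs} → Spaced xs → (∀ {a b} → a ∈ xs → b ∈ xs → b ≤ a + D) → 3 * length xs ≤ D + 3
spread-length [] _ = z≤n
spread-length {D} {x ∷ xs} spaced spread = +-cancelʳ-≤ x _ _ (begin
  3 * length (x ∷ xs) + x  ≤⟨ spaced-length (≤-trans (m≤m+n x D) (m≤m+n (x + D) 3)) spaced window ⟩
  x + D + 3                ≡⟨ trans (+-assoc x D 3) (+-comm x (D + 3)) ⟩
  D + 3 + x                ∎)
  where
  open ≤-Reasoning
  window : All (λ y → x ≤ y × y ≤ x + D) (x ∷ xs)
  window = All.zip (spaced-head-minimal spaced , All.tabulate (spread (here refl)))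

length-filter-split : ∀ {A : Set} {P : Pred A 0ℓ} (P? : Decidable P) xs →
                      length xs ≡ length (filter P? xs) + length (filter (¬? ∘ P?) xs)
length-filter-split P? [] = refl
length-filter-split P? (x ∷ xs) with P? x
... | yes _ = cong suc (length-filter-split P? xs)
... | no _  = trans (cong suc (length-filter-split P? xs)) (sym (+-suc _ _))

length-filter-map : ∀ {A B : Set} {P : Pred B 0ℓ} (P? : Decidable P) (f : A → B) xs →
                    length (filter P? (map f xs)) ≡ length (filter (P? ∘ f) xs)
length-filter-map P? f [] = refl
length-filter-map P? f (x ∷ xs) with P? (f x)
... | yes _ = cong suc (length-filter-map P? f xs)
... | no _  = length-filter-map P? f xs

allPairs-map-under-All : ∀ {A : Set} {P : Pred A 0ℓ} {R S : A → A → Set} {xs} →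
                         (∀ {a b} → P a → P b → R a b → S a b) → All P xs → AllPairs R xs → AllPairs S xs
allPairs-map-under-All f []         []         = []
allPairs-map-under-All f (pa ∷ pxs) (ra ∷ rxs) =
  All.zipWith (λ (pb , r) → f pa pb r) (pxs , ra) ∷ allPairs-map-under-All f pxs rxs

maximum : ∀ x xs → ∃[ m ] m ∈ x ∷ xs × All (_≤ m) (x ∷ xs)
maximum x xs = max x xs , [ here , there ]′ (argmax-sel id x xs) , ⊥≤max x xs ∷ xs≤max x xs

3x<3[1+k]⇒x≤k : ∀ {x k} → 3 * x < 3 * suc k → x ≤ k
3x<3[1+k]⇒x≤k {x} {k} lt = ≤-pred (*-cancelˡ-< 3 x (suc k) lt)

3x≤2k+3⇒x≤k : ∀ {x k} → 1 ≤ k → 3 * x ≤ 2 * k + 3 → x ≤ k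
3x≤2k+3⇒x≤k {x} {k} k≥1 le = 3x<3[1+k]⇒x≤k (begin-strict
  3 * x      ≤⟨ le ⟩
  2 * k + 3  <⟨ +-monoˡ-< 3 (m<n+m (2 * k) k≥1) ⟩
  3 * k + 3  ≡⟨ +-comm (3 * k) 3 ⟩
  3 + 3 * k  ≡⟨ *-suc 3 k ⟨
  3 * suc k  ∎)
  where open ≤-Reasoning

offset-bound : ∀ {j s t a b} → j ≤ s + t → a + s ≡ b → j + a ≤ b + t
offset-bound {j} {s} {t} {a} j≤s+t refl = begin
  j + a      ≤⟨ +-monoˡ-≤ a j≤s+t ⟩
  s + t + a  ≡⟨ rotate s t a ⟩
  a + s + t  ∎
  where
  open ≤-Reasoning
  rotate : ∀ s t a → s + t + a ≡ a + s + t
  rotate = solve-∀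

tripod-bound : ∀ {k α β γ} → 1 ≤ k →
               3 * (α + β) ≤ 2 * k + 3 → 3 * γ ≤ 2 * k + 3 →
               (0 < α → 0 < γ → 3 * (α + γ) ≤ 2 * k) →
               (0 < β → 0 < γ → 3 * (β + γ) ≤ 2 * k) →
               α + β + γ ≤ k
tripod-bound {k} {γ = zero} k≥1 αβ _ _ _ = subst (_≤ k) (sym (+-identityʳ _)) (3x≤2k+3⇒x≤k k≥1 αβ)
tripod-bound {α = zero} {zero} {suc γ} k≥1 _ γ-bound _ _ = 3x≤2k+3⇒x≤k k≥1 γ-bound
tripod-bound {α = zero} {suc β} {suc γ} k≥1 _ _ _ βγ =
  3x≤2k+3⇒x≤k k≥1 (≤-trans (βγ z<s z<s) (m≤m+n _ 3))
tripod-bound {k} {suc α} {zero} {suc γ} k≥1 _ _ αγ _ =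
  subst (_≤ k) (cong (_+ suc γ) (sym (+-identityʳ (suc α))))
        (3x≤2k+3⇒x≤k k≥1 (≤-trans (αγ z<s z<s) (m≤m+n _ 3)))
tripod-bound {k} {suc α} {suc β} {suc γ} _ αβ _ αγ βγ = 3x<3[1+k]⇒x≤k (*-cancelˡ-< 2 _ _ (begin-strict
  2 * (3 * (a + b + g))                    ≡⟨ pairs a b g ⟩
  3 * (a + b) + 3 * (a + g) + 3 * (b + g)  ≤⟨ +-mono-≤ (+-mono-≤ αβ (αγ z<s z<s)) (βγ z<s z<s) ⟩
  2 * k + 3 + 2 * k + 2 * k                <⟨ m<m+n _ {3} z<s ⟩
  2 * k + 3 + 2 * k + 2 * k + 3            ≡⟨ six k ⟩
  2 * (3 * suc k)                          ∎))
  where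
  open ≤-Reasoning
  a b g : ℕ
  a = suc α
  b = suc β
  g = suc γ
  pairs : ∀ a b g → 2 * (3 * (a + b + g)) ≡ 3 * (a + b) + 3 * (a + g) + 3 * (b + g)
  pairs = solve-∀
  six : ∀ k → 2 * k + 3 + 2 * k + 2 * k + 3 ≡ 2 * (3 * suc k)
  six = solve-∀

left-arm-branch-bound : ∀ {k h ls js} → Spaced ls → Spaced js → All (_≤ h) ls → All (h + 6 ≤_) js →
                        (∀ {i j} → i ∈ ls → j ∈ js → j + i ≤ h + 2 * k) →
                        0 < length ls → 0 < length js → 3 * (length ls + length js) ≤ 2 * k
left-arm-branch-bound {k} {h} {l ∷ ls} {j ∷ js} spacedL spacedJ ls≤h js≥ cross _ _
  with maximum l ls | maximum j js
... | mL , mL∈ , ≤mL | mJ , mJ∈ , ≤mJ = +-cancelʳ-≤ (h + 6) _ _ (begin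
  3 * (α + γ) + (h + 6)            ≡⟨ regroup α γ h ⟩
  3 * α + 0 + (3 * γ + (h + 6))    ≤⟨ +-mono-≤ arm branch ⟩
  mL + 3 + (mJ + 3)                ≡⟨ recentre mL mJ ⟩
  mJ + mL + 6                      ≤⟨ +-monoˡ-≤ 6 (cross mL∈ mJ∈) ⟩
  h + 2 * k + 6                    ≡⟨ swap h (2 * k) ⟩
  2 * k + (h + 6)                  ∎)
  where
  open ≤-Reasoning
  α γ : ℕ
  α = length (l ∷ ls)
  γ = length (j ∷ js)
  arm : 3 * α + 0 ≤ mL + 3
  arm = spaced-length z≤n spacedL (All.map (z≤n ,_) ≤mL)
  branch : 3 * γ + (h + 6) ≤ mJ + 3
  branch = spaced-length (≤-trans (All.lookup js≥ mJ∈) (m≤m+n mJ 3)) spacedJ (All.zip (js≥ , ≤mJ))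
  regroup : ∀ a g h → 3 * (a + g) + (h + 6) ≡ 3 * a + 0 + (3 * g + (h + 6))
  regroup = solve-∀
  recentre : ∀ mL mJ → mL + 3 + (mJ + 3) ≡ mJ + mL + 6
  recentre = solve-∀
  swap : ∀ h k → h + k + 6 ≡ k + (h + 6)
  swap = solve-∀

right-arm-branch-bound : ∀ {k h rs js} → Spaced rs → Spaced js → All (_≤ 2 * h) rs → All (h + 6 ≤_) js →
                         (∀ {i j} → i ∈ rs → j ∈ js → j + h ≤ i + 2 * k) →
                         0 < length rs → 0 < length js → 3 * (length rs + length js) ≤ 2 * k
right-arm-branch-bound {k} {h} {r ∷ rs} {j ∷ js} spacedR spacedJ rs≤2h js≥ cross _ _
  with maximum j js
... | mJ , mJ∈ , ≤mJ = +-cancelʳ-≤ (r + 2 * h + 6) _ _ (begin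
  3 * (β + γ) + (r + 2 * h + 6)        ≡⟨ regroup β γ r h ⟩
  3 * β + r + (3 * γ + (h + 6)) + h    ≤⟨ +-monoˡ-≤ h (+-mono-≤ arm branch) ⟩
  2 * h + 3 + (mJ + 3) + h             ≡⟨ recentre h mJ ⟩
  2 * h + 6 + (mJ + h)                 ≤⟨ +-monoʳ-≤ (2 * h + 6) (cross (here refl) mJ∈) ⟩
  2 * h + 6 + (r + 2 * k)              ≡⟨ swap h r (2 * k) ⟩
  2 * k + (r + 2 * h + 6)              ∎)
  where
  open ≤-Reasoning
  β γ : ℕ
  β = length (r ∷ rs)
  γ = length (j ∷ js)
  arm : 3 * β + r ≤ 2 * h + 3
  arm = spaced-length (≤-trans (All.lookup rs≤2h (here refl)) (m≤m+n _ 3)) spacedR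
                      (All.zip (spaced-head-minimal spacedR , rs≤2h))
  branch : 3 * γ + (h + 6) ≤ mJ + 3
  branch = spaced-length (≤-trans (All.lookup js≥ mJ∈) (m≤m+n mJ 3)) spacedJ (All.zip (js≥ , ≤mJ))
  regroup : ∀ b g r h → 3 * (b + g) + (r + 2 * h + 6) ≡ 3 * b + r + (3 * g + (h + 6)) + h
  regroup = solve-∀
  recentre : ∀ h mJ → 2 * h + 3 + (mJ + 3) + h ≡ 2 * h + 6 + (mJ + h)
  recentre = solve-∀
  swap : ∀ h r k → 2 * h + 6 + (r + k) ≡ k + (r + 2 * h + 6)
  swap = solve-∀

tripod-packing : ∀ {k h is js} → 1 ≤ k → Spaced is → Spaced js → All (_≤ 2 * h) is → All (h + 6 ≤_) js →
                 (∀ {i i′} → i ∈ is → i′ ∈ is → i′ ≤ i + 2 * k) →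
                 (∀ {j j′} → j ∈ js → j′ ∈ js → j′ ≤ j + 2 * k) →
                 (∀ {i j} → i ∈ is → j ∈ js → i ≤ h → j + i ≤ h + 2 * k) →
                 (∀ {i j} → i ∈ is → j ∈ js → h ≤ i → j + h ≤ i + 2 * k) →
                 length is + length js ≤ k
tripod-packing {k} {h} {is} {js} k≥1 spaced-is spaced-js is≤2h js≥ spread-is spread-js cross-below cross-above =
  subst (_≤ k) (cong (_+ length js) (sym split))
    (tripod-bound k≥1 (subst (λ a → 3 * a ≤ 2 * k + 3) split (spread-length spaced-is spread-is))
                      (spread-length spaced-js spread-js)
                      (left-arm-branch-bound {k} (AllPairs.filter⁺ (_<? h) spaced-is) spaced-js left≤h js≥ cross-left)
                      (right-arm-branch-bound {k} (AllPairs.filter⁺ ≮h? spaced-is) spaced-js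
                                                  (All.filter⁺ ≮h? is≤2h) js≥ cross-right))
  where
  ≮h? : Decidable (λ i → ¬ i < h)
  ≮h? = ¬? ∘ (_<? h)

  split : length is ≡ length (filter (_<? h) is) + length (filter ≮h? is)
  split = length-filter-split (_<? h) is

  left≤h : All (_≤ h) (filter (_<? h) is)
  left≤h = All.tabulate (λ i∈ → <⇒≤ (proj₂ (∈-filter⁻ (_<? h) {xs = is} i∈)))

  cross-left : ∀ {i j} → i ∈ filter (_<? h) is → j ∈ js → j + i ≤ h + 2 * k
  cross-left i∈ j∈ with i∈is , i<h ← ∈-filter⁻ (_<? h) {xs = is} i∈ = cross-below i∈is j∈ (<⇒≤ i<h)

  cross-right : ∀ {i j} → i ∈ filter ≮h? is → j ∈ js → j + h ≤ i + 2 * k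
  cross-right i∈ j∈ with i∈is , i≮h ← ∈-filter⁻ ≮h? {xs = is} i∈ = cross-above i∈is j∈ (≮⇒≥ i≮h)

fromList : ∀ {n} → List (Fin n) → Subset n
fromList = foldr (λ x p → ⁅ x ⁆ ∪ p) ⊥

∈-fromList⁺ : ∀ {n} {x : Fin n} {xs} → x ∈ xs → x ∈ₛ fromList xs
∈-fromList⁺ (here refl)  = x∈p∪q⁺ (inj₁ (x∈⁅x⁆ _))
∈-fromList⁺ (there x∈xs) = x∈p∪q⁺ (inj₂ (∈-fromList⁺ x∈xs))

∈-fromList⁻ : ∀ {n} {x : Fin n} {xs} → x ∈ₛ fromList xs → x ∈ xs
∈-fromList⁻ {xs = []}     x∈⊥ = ⊥-elim (∉⊥ x∈⊥)
∈-fromList⁻ {xs = y ∷ ys} x∈ with x∈p∪q⁻ ⁅ y ⁆ (fromList ys) x∈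
... | inj₁ x∈⁅y⁆ = here (x∈⁅y⁆⇒x≡y y x∈⁅y⁆)
... | inj₂ x∈ys  = there (∈-fromList⁻ x∈ys)

∣p∪q∣≤∣p∣+∣q∣ : ∀ {n} (p q : Subset n) → ∣ p ∪ q ∣ ≤ ∣ p ∣ + ∣ q ∣
∣p∪q∣≤∣p∣+∣q∣ Vec.[]            Vec.[]            = z≤n
∣p∪q∣≤∣p∣+∣q∣ (inside  Vec.∷ p) (inside  Vec.∷ q) = s≤s (≤-trans (∣p∪q∣≤∣p∣+∣q∣ p q) (+-monoʳ-≤ ∣ p ∣ (n≤1+n ∣ q ∣)))
∣p∪q∣≤∣p∣+∣q∣ (inside  Vec.∷ p) (outside Vec.∷ q) = s≤s (∣p∪q∣≤∣p∣+∣q∣ p q)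
∣p∪q∣≤∣p∣+∣q∣ (outside Vec.∷ p) (inside  Vec.∷ q) = subst (suc ∣ p ∪ q ∣ ≤_) (sym (+-suc ∣ p ∣ ∣ q ∣))
                                                          (s≤s (∣p∪q∣≤∣p∣+∣q∣ p q))
∣p∪q∣≤∣p∣+∣q∣ (outside Vec.∷ p) (outside Vec.∷ q) = ∣p∪q∣≤∣p∣+∣q∣ p q

∣fromList∣≤length : ∀ {n} (xs : List (Fin n)) → ∣ fromList xs ∣ ≤ length xs
∣fromList∣≤length {n} []       = ≤-reflexive (∣⊥∣≡0 n)
∣fromList∣≤length     (x ∷ xs) = ≤-trans (∣p∪q∣≤∣p∣+∣q∣ ⁅ x ⁆ (fromList xs))
                                         (+-mono-≤ (≤-reflexive (∣⁅x⁆∣≡1 x)) (∣fromList∣≤length xs))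

∣p∩fromList∣≤length-filter : ∀ {n} (p : Subset n) xs → ∣ p ∩ fromList xs ∣ ≤ length (filter (_∈? p) xs)
∣p∩fromList∣≤length-filter p xs = ≤-trans (p⊆q⇒∣p∣≤∣q∣ p∩xs⊆) (∣fromList∣≤length (filter (_∈? p) xs))
  where
  p∩xs⊆ : p ∩ fromList xs ⊆ fromList (filter (_∈? p) xs)
  p∩xs⊆ z∈ with z∈p , z∈xs ← x∈p∩q⁻ p (fromList xs) z∈ =
    ∈-fromList⁺ {xs = filter (_∈? p) xs} (∈-filter⁺ (_∈? p) (∈-fromList⁻ {xs = xs} z∈xs) z∈p)

unique⇒length≤∣p∣ : ∀ {n} {xs : List (Fin n)} {p} → Unique xs → All (_∈ₛ p) xs → length xs ≤ ∣ p ∣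
unique⇒length≤∣p∣ []                [] = z≤n
unique⇒length≤∣p∣ {xs = x ∷ xs} {p} (x∉xs ∷ unique) (x∈p ∷ xs∈p) =
  ≤-trans (s≤s (unique⇒length≤∣p∣ unique xs∈p-x)) (p⊂q⇒∣p∣<∣q∣ (x∈p⇒p-x⊂p x∈p))
  where
  xs∈p-x : All (_∈ₛ p - x) xs
  xs∈p-x = All.zipWith (λ (x≢y , y∈p) → x∈p∧x≢y⇒x∈p-y y∈p (≢-sym x≢y)) (x∉xs , xs∈p)

module _ {n : ℕ} (G : Graph n) where

  -- A record rather than T (reach G k x y) itself, so that k, x and y are recoverable by unification.
  record Within (k : ℕ) (x y : Fin n) : Set where
    constructor reached
    field reach≡true : T (reach G k x y)

  within-refl : ∀ x → Within 0 x x
  within-refl x = reached (fromWitness refl)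

  within-0⇒≡ : ∀ {x y} → Within 0 x y → x ≡ y
  within-0⇒≡ (reached xy) = toWitness xy

  within-suc : ∀ {k x y} → Within k x y → Within (suc k) x y
  within-suc (reached xy) = reached (Equivalence.from T-∨ (inj₁ xy))

  within-step : ∀ {k x w y} → Within k x w → T (adj G w y) → Within (suc k) x y
  within-step {w = w} (reached xw) wy = reached (Equivalence.from T-∨ (inj₂
    (any⁺ _ (Any.map (λ { refl → Equivalence.from T-∧ (xw , wy) }) (∈-allFin w)))))

  within-suc⁻ : ∀ {k x y} → Within (suc k) x y → Within k x y ⊎ ∃[ w ] Within k x w × T (adj G w y)
  within-suc⁻ (reached xy) with Equivalence.to T-∨ xy
  ... | inj₁ xy′ = inj₁ (reached xy′)
  ... | inj₂ via with w , xwy ← satisfied (any⁻ _ (allFin n) via) with xw , wy ← Equivalence.to T-∧ xwy =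
    inj₂ (w , reached xw , wy)

  within-≤ : ∀ {k k′ x y} → k ≤ k′ → Within k x y → Within k′ x y
  within-≤ k≤k′ = go (≤⇒≤′ k≤k′)
    where
    go : ∀ {k k′ x y} → k ≤′ k′ → Within k x y → Within k′ x y
    go ≤′-refl        xy = xy
    go (≤′-step k≤k′) xy = within-suc (go k≤k′ xy)

  within-trans : ∀ {a b x y z} → Within a x y → Within b y z → Within (a + b) x z
  within-trans {a} {zero} {x} {z = z} xy yz =
    subst (λ t → Within t x z) (sym (+-identityʳ a)) (subst (Within a x) (within-0⇒≡ yz) xy)
  within-trans {a} {suc b} {x} {y} {z} xy yz = subst (λ t → Within t x z) (sym (+-suc a b)) (extend (within-suc⁻ yz))
    where
    extend : Within b y z ⊎ ∃[ w ] Within b y w × T (adj G w z) → Within (suc (a + b)) x z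
    extend (inj₁ yz′)           = within-suc (within-trans xy yz′)
    extend (inj₂ (w , yw , wz)) = within-step (within-trans xy yw) wz

  adj-sym : ∀ {x y} → T (adj G x y) → T (adj G y x)
  adj-sym {x} {y} = subst T (Graph.sym G x y)

  adj⇒within-1 : ∀ {x y} → T (adj G x y) → Within 1 x y
  adj⇒within-1 = within-step (within-refl _)

  within-sym : ∀ {k x y} → Within k x y → Within k y x
  within-sym {zero}  xy rewrite within-0⇒≡ xy = within-refl _
  within-sym {suc k} xy with within-suc⁻ xy
  ... | inj₁ xy′           = within-suc (within-sym xy′)
  ... | inj₂ (w , xw , wy) = within-trans {1} (adj⇒within-1 (adj-sym wy)) (within-sym xw)

  within-suc⁻ˡ : ∀ {k x y} → Within (suc k) x y → ∃[ w ] Within 1 x w × Within k w y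
  within-suc⁻ˡ {x = x} xy with within-suc⁻ (within-sym xy)
  ... | inj₁ yx            = x , within-suc (within-refl x) , within-sym yx
  ... | inj₂ (w , yw , wx) = w , adj⇒within-1 (adj-sym wx) , within-sym yw

  within-diameter : ∀ {k x y z} → Within k x y → Within k x z → Within (2 * k) y z
  within-diameter {k} {y = y} {z} xy xz =
    subst (λ t → Within t y z) (cong (k +_) (sym (+-identityʳ k))) (within-trans (within-sym xy) xz)

  DistAtLeast : Fin n → Fin n → ℕ → Set
  DistAtLeast x y i = ∀ {t} → Within t x y → i ≤ t

  Dist : Fin n → Fin n → ℕ → Set
  Dist x y i = Within i x y × DistAtLeast x y i

  triangle : ∀ {i j t x y z} → DistAtLeast x z j → Within i x y → Within t y z → j ≤ i + t
  triangle far xy yz = far (within-trans xy yz)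

  dist-unique : ∀ {i j x y} → Dist x y i → Dist x y j → i ≡ j
  dist-unique (xy , far) (xy′ , far′) = ≤-antisym (far xy′) (far′ xy)

  within⇒dist : ∀ {k x y} → Within k x y → ∃[ i ] Dist x y i
  within⇒dist {zero}      xy = 0 , xy , λ _ → z≤n
  within⇒dist {suc k} {x} {y} xy with T? (reach G k x y)
  ... | yes xy′ = within⇒dist {k} (reached xy′)
  ... | no ¬xy′ = suc k , xy , λ xyt → ≰⇒> (λ t≤k → ¬xy′ (Within.reach≡true (within-≤ t≤k xyt)))

  isDist⇒dist : ∀ {x y i} → IsDist G x y i → Dist x y i
  isDist⇒dist (xy , closer-fails) =
    reached (Equivalence.from T-≡ xy) , λ (reached xyt) → ≮⇒≥ (λ t<i → subst T (closer-fails _ t<i) xyt)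

  Walk : ℕ → (ℕ → Fin n) → Set
  Walk L p = ∀ {i} → i < L → Within 1 (p i) (p (suc i))

  walk-segment : ∀ {L p} → Walk L p → ∀ i s → i + s ≤ L → Within s (p i) (p (i + s))
  walk-segment {p = p} walk i zero _ = subst (Within 0 (p i) ∘ p) (sym (+-identityʳ i)) (within-refl (p i))
  walk-segment {L} {p} walk i (suc s) i+[1+s]≤L =
    subst₂ (λ t j → Within t (p i) (p j)) (+-comm s 1) (sym (+-suc i s))
           (within-trans (walk-segment walk i s (<⇒≤ i+s+1≤L)) (walk i+s+1≤L))
    where
    i+s+1≤L : suc (i + s) ≤ L
    i+s+1≤L = subst (_≤ L) (+-suc i s) i+[1+s]≤L

  within⇒walk : ∀ {L x y} → Within L x y → ∃[ p ] p 0 ≡ x × p L ≡ y × Walk L p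
  within⇒walk {zero}  {x} xy = (λ _ → x) , refl , within-0⇒≡ xy , λ ()
  within⇒walk {suc L} {x} xy
    with w , xw , wy ← within-suc⁻ˡ xy
    with p , p0≡w , pL≡y , walk ← within⇒walk wy =
    x∷p , refl , pL≡y , walk′
    where
    x∷p : ℕ → Fin n
    x∷p zero    = x
    x∷p (suc i) = p i
    walk′ : Walk (suc L) x∷p
    walk′ {zero}  _         = subst (Within 1 x) (sym p0≡w) xw
    walk′ {suc i} (s≤s i<L) = walk i<L

  walk-dist : ∀ {L p} → Walk L p → DistAtLeast (p 0) (p L) L → ∀ {i} → i ≤ L → Dist (p 0) (p i) i
  walk-dist walk far {i} i≤L with o , refl ← m≤n⇒∃[o]m+o≡n i≤L =
    walk-segment walk 0 i i≤L , λ {t} xpi → +-cancelʳ-≤ o i t (triangle far xpi (walk-segment walk i o ≤-refl))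

  record Geodesic (x : Fin n) (L : ℕ) : Set where
    field
      vertex  : ℕ → Fin n
      segment : ∀ i s → i + s ≤ L → Within s (vertex i) (vertex (i + s))
      dist    : ∀ {i} → i ≤ L → Dist x (vertex i) i

  dist⇒geodesic : ∀ {x y L} → Dist x y L → Geodesic x L
  dist⇒geodesic (xy , far) with p , refl , refl , walk ← within⇒walk xy = record
    { vertex  = p
    ; segment = walk-segment walk
    ; dist    = walk-dist walk far
    }

  eccentric-vertex : ∀ {r} → Connected G → (∀ v j → j < r → ∃[ u ] reach G j v u ≡ false) →
                     ∀ c → ∃[ w ] ∃[ ℓ ] Dist c w ℓ × r ≤ ℓ
  eccentric-vertex {zero} _ _ c = c , 0 , (within-refl c , λ _ → z≤n) , z≤n
  eccentric-vertex {suc r} connected not-within-r c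
    with w , unreached ← not-within-r c r ≤-refl
    with k , reached-k ← connected c w
    with ℓ , cw ← within⇒dist {k} (reached (Equivalence.from T-≡ reached-k)) =
    w , ℓ , cw , ≰⇒> (λ ℓ≤r → subst T unreached (Within.reach≡true (within-≤ ℓ≤r (proj₁ cw))))

  ∈-ball⁻ : ∀ k x {z} → z ∈ₛ ball G k x → Within k x z
  ∈-ball⁻ k x {z} z∈ =
    reached (Equivalence.from T-≡ (trans (sym (lookup∘tabulate (reach G k x) z)) ([]=⇒lookup z∈)))

module Tripod {n} (G : Graph n) {u : Fin n} {d h ℓ : ℕ}
              (P : Geodesic G u d) (h≤d : h ≤ d) (d≤2h : d ≤ 2 * h)
              (Q : Geodesic G (Geodesic.vertex P h) ℓ)
              {is js : List ℕ} (spaced-is : Spaced is) (spaced-js : Spaced js)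
              (is≤d : All (_≤ d) is) (js-range : All (λ j → h + 6 ≤ j × j ≤ ℓ) js) where

  open Geodesic P using () renaming (vertex to p; segment to p-segment; dist to p-dist)
  open Geodesic Q using () renaming (vertex to q; dist to q-dist)

  c : Fin n
  c = p h

  vertices : List (Fin n)
  vertices = map p is ++ map q js

  S : Subset n
  S = fromList vertices

  centre-below : ∀ {i s} → i + s ≡ h → Within G s c (p i)
  centre-below {i} {s} i+s≡h =
    within-sym G (subst (Within G s (p i) ∘ p) i+s≡h (p-segment i s (≤-trans (≤-reflexive i+s≡h) h≤d)))

  centre-above : ∀ {i s} → i ≤ d → h + s ≡ i → Within G s c (p i)
  centre-above {i} {s} i≤d h+s≡i = subst (Within G s c ∘ p) h+s≡i (p-segment h s (subst (_≤ d) (sym h+s≡i) i≤d))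

  centre-near : ∀ {i} → i ≤ d → ∃[ s ] s ≤ h × Within G s c (p i)
  centre-near {i} i≤d with ≤-total i h
  ... | inj₁ i≤h with s , i+s≡h ← m≤n⇒∃[o]m+o≡n i≤h = s , subst (s ≤_) i+s≡h (m≤n+m s i) , centre-below i+s≡h
  ... | inj₂ h≤i with s , h+s≡i ← m≤n⇒∃[o]m+o≡n h≤i =
    s , +-cancelˡ-≤ h s h (≤-trans (≤-reflexive h+s≡i) (≤-trans i≤d (subst (d ≤_) (cong (h +_) (+-identityʳ h)) d≤2h)))
      , centre-above i≤d h+s≡i

  unique-vertices : Unique vertices
  unique-vertices = AllPairs.++⁺ (AllPairs.map⁺ (allPairs-map-under-All p-distinct is≤d spaced-is))
                                 (AllPairs.map⁺ (allPairs-map-under-All q-distinct js-range spaced-js))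
                                 (All.map⁺ (All.map (λ i≤d → All.map⁺ (All.map (p≢q i≤d) js-range)) is≤d))
    where
    spaced⇒≢ : ∀ {a b} → a + 3 ≤ b → a ≢ b
    spaced⇒≢ {a} a+3≤b refl = m+1+n≰m a a+3≤b
    p-distinct : ∀ {i i′} → i ≤ d → i′ ≤ d → i + 3 ≤ i′ → p i ≢ p i′
    p-distinct i≤d i′≤d i+3≤i′ pi≡pi′ =
      spaced⇒≢ i+3≤i′ (dist-unique G (p-dist i≤d) (subst (λ x → Dist G u x _) (sym pi≡pi′) (p-dist i′≤d)))
    q-distinct : ∀ {j j′} → h + 6 ≤ j × j ≤ ℓ → h + 6 ≤ j′ × j′ ≤ ℓ → j + 3 ≤ j′ → q j ≢ q j′
    q-distinct (_ , j≤ℓ) (_ , j′≤ℓ) j+3≤j′ qj≡qj′ =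
      spaced⇒≢ j+3≤j′ (dist-unique G (q-dist j≤ℓ) (subst (λ x → Dist G c x _) (sym qj≡qj′) (q-dist j′≤ℓ)))
    p≢q : ∀ {i j} → i ≤ d → h + 6 ≤ j × j ≤ ℓ → p i ≢ q j
    p≢q i≤d (h+6≤j , j≤ℓ) pi≡qj with s , s≤h , c-pi ← centre-near i≤d =
      m+1+n≰m h (≤-trans h+6≤j (≤-trans (proj₂ (q-dist j≤ℓ) (subst (Within G s c) pi≡qj c-pi)) s≤h))

  size : length is + length js ≤ ∣ S ∣
  size = begin
    length is + length js                  ≡⟨ cong₂ _+_ (length-map p is) (length-map q js) ⟨
    length (map p is) + length (map q js)  ≡⟨ length-++ (map p is) ⟨
    length vertices                        ≤⟨ unique⇒length≤∣p∣ unique-vertices (All.tabulate ∈-fromList⁺) ⟩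
    ∣ S ∣                                  ∎
    where open ≤-Reasoning

  multipacking : IsMultipacking G S
  multipacking x k k≥1 = begin
    ∣ B ∩ S ∣                            ≤⟨ ∣p∩fromList∣≤length-filter B vertices ⟩
    length (filter (_∈? B) vertices)     ≡⟨ counts ⟩
    length is′ + length js′              ≤⟨ tripod-packing k≥1 (AllPairs.filter⁺ _ spaced-is) (AllPairs.filter⁺ _ spaced-js)
                                              (All.filter⁺ _ (All.map (λ i≤d → ≤-trans i≤d d≤2h) is≤d))
                                              (All.filter⁺ _ (All.map proj₁ js-range))
                                              spread-is spread-js cross-below cross-above ⟩
    k                                    ∎
    where
    open ≤-Reasoning
    B : Subset n
    B = ball G k x

    is′ js′ : List ℕ
    is′ = filter (λ i → p i ∈? B) is
    js′ = filter (λ j → q j ∈? B) js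

    counts : length (filter (_∈? B) vertices) ≡ length is′ + length js′
    counts = begin-equality
      length (filter (_∈? B) vertices)                                   ≡⟨ cong length (filter-++ (_∈? B) (map p is) (map q js)) ⟩
      length (filter (_∈? B) (map p is) ++ filter (_∈? B) (map q js))    ≡⟨ length-++ (filter (_∈? B) (map p is)) ⟩
      length (filter (_∈? B) (map p is)) + length (filter (_∈? B) (map q js))
        ≡⟨ cong₂ _+_ (length-filter-map (_∈? B) p is) (length-filter-map (_∈? B) q js) ⟩
      length is′ + length js′                                            ∎

    member-is : ∀ {i} → i ∈ is′ → i ≤ d × p i ∈ₛ B
    member-is i∈ with i∈is , pi∈B ← ∈-filter⁻ (λ i → p i ∈? B) {xs = is} i∈ = All.lookup is≤d i∈is , pi∈B

    member-js : ∀ {j} → j ∈ js′ → j ≤ ℓ × q j ∈ₛ B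
    member-js j∈ with j∈js , qj∈B ← ∈-filter⁻ (λ j → q j ∈? B) {xs = js} j∈ = proj₂ (All.lookup js-range j∈js) , qj∈B

    close : ∀ {y z} → y ∈ₛ B → z ∈ₛ B → Within G (2 * k) y z
    close y∈B z∈B = within-diameter G (∈-ball⁻ G k x y∈B) (∈-ball⁻ G k x z∈B)

    spread-is : ∀ {i i′} → i ∈ is′ → i′ ∈ is′ → i′ ≤ i + 2 * k
    spread-is i∈ i′∈ with i≤d , pi∈B ← member-is i∈ | i′≤d , pi′∈B ← member-is i′∈ =
      triangle G (proj₂ (p-dist i′≤d)) (proj₁ (p-dist i≤d)) (close pi∈B pi′∈B)

    spread-js : ∀ {j j′} → j ∈ js′ → j′ ∈ js′ → j′ ≤ j + 2 * k
    spread-js j∈ j′∈ with j≤ℓ , qj∈B ← member-js j∈ | j′≤ℓ , qj′∈B ← member-js j′∈ =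
      triangle G (proj₂ (q-dist j′≤ℓ)) (proj₁ (q-dist j≤ℓ)) (close qj∈B qj′∈B)

    branch-bound : ∀ {i j s} → i ∈ is′ → j ∈ js′ → Within G s c (p i) → j ≤ s + 2 * k
    branch-bound i∈ j∈ c-pi with _ , pi∈B ← member-is i∈ | j≤ℓ , qj∈B ← member-js j∈ =
      triangle G (proj₂ (q-dist j≤ℓ)) c-pi (close pi∈B qj∈B)

    cross-below : ∀ {i j} → i ∈ is′ → j ∈ js′ → i ≤ h → j + i ≤ h + 2 * k
    cross-below i∈ j∈ i≤h with s , i+s≡h ← m≤n⇒∃[o]m+o≡n i≤h =
      offset-bound (branch-bound i∈ j∈ (centre-below i+s≡h)) i+s≡h

    cross-above : ∀ {i j} → i ∈ is′ → j ∈ js′ → h ≤ i → j + h ≤ i + 2 * k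
    cross-above i∈ j∈ h≤i with s , h+s≡i ← m≤n⇒∃[o]m+o≡n h≤i =
      offset-bound (branch-bound i∈ j∈ (centre-above (proj₁ (member-is i∈)) h+s≡i)) h+s≡i

halve : ∀ d → ∃[ h ] h ≤ d × d ≤ 2 * h × 2 * h ≤ suc d
halve zero          = 0 , z≤n , z≤n , z≤n
halve (suc zero)    = 1 , ≤-refl , s≤s z≤n , ≤-refl
halve (suc (suc d)) with h , h≤d , d≤2h , 2h≤1+d ← halve d =
  suc h , s≤s (m≤n⇒m≤1+n h≤d)
        , subst (suc (suc d) ≤_) (double-suc h) (s≤s (s≤s d≤2h))
        , subst (_≤ suc (suc (suc d))) (double-suc h) (s≤s (s≤s 2h≤1+d))
  where
  double-suc : ∀ h → 2 + 2 * h ≡ 2 * suc h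
  double-suc = solve-∀

tripod-size-bound : ∀ {d r h ℓ a b} → r ≤ ℓ → 2 * h ≤ suc d → d < 3 * a → ℓ < h + 6 + 3 * b →
                    d + 2 * r ≤ 6 * (a + b) + 9
tripod-size-bound {d} {r} {h} {ℓ} {a} {b} r≤ℓ 2h≤1+d d<3a ℓ<h+6+3b = +-cancelʳ-≤ 2 _ _ (begin
  d + 2 * r + 2             ≤⟨ +-monoˡ-≤ 2 (+-monoʳ-≤ d (*-monoʳ-≤ 2 r≤ℓ)) ⟩
  d + 2 * ℓ + 2             ≡⟨ step₁ d ℓ ⟩
  d + 2 * suc ℓ             ≤⟨ +-monoʳ-≤ d (*-monoʳ-≤ 2 ℓ<h+6+3b) ⟩
  d + 2 * (h + 6 + 3 * b)   ≡⟨ step₂ d h b ⟩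
  2 * h + d + 12 + 6 * b    ≤⟨ +-monoˡ-≤ (6 * b) (+-monoˡ-≤ 12 (+-monoˡ-≤ d 2h≤1+d)) ⟩
  suc d + d + 12 + 6 * b    ≡⟨ step₃ d b ⟩
  2 * suc d + 11 + 6 * b    ≤⟨ +-monoˡ-≤ (6 * b) (+-monoˡ-≤ 11 (*-monoʳ-≤ 2 d<3a)) ⟩
  2 * (3 * a) + 11 + 6 * b  ≡⟨ step₄ a b ⟩
  6 * (a + b) + 9 + 2       ∎)
  where
  open ≤-Reasoning
  step₁ : ∀ d ℓ → d + 2 * ℓ + 2 ≡ d + 2 * suc ℓ
  step₁ = solve-∀
  step₂ : ∀ d h b → d + 2 * (h + 6 + 3 * b) ≡ 2 * h + d + 12 + 6 * b
  step₂ = solve-∀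
  step₃ : ∀ d b → suc d + d + 12 + 6 * b ≡ 2 * suc d + 11 + 6 * b
  step₃ = solve-∀
  step₄ : ∀ a b → 2 * (3 * a) + 11 + 6 * b ≡ 6 * (a + b) + 9 + 2
  step₄ = solve-∀

large-multipacking : ∀ {n} (G : Graph n) {d r u v} → Connected G → IsDist G u v d →
                     (∀ v j → j < r → ∃[ u ] reach G j v u ≡ false) →
                     ∃[ S ] IsMultipacking G S × d + 2 * r ≤ 6 * ∣ S ∣ + 9
large-multipacking G {d} connected diametral not-within =
  let P                        = dist⇒geodesic G (isDist⇒dist G diametral)
      h , h≤d , d≤2h , 2h≤1+d  = halve d
      w , ℓ , cw , r≤ℓ         = eccentric-vertex G connected not-within (Geodesic.vertex P h)
      nA , A≤d , d<3nA         = progression-covering 0 d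
      nB , B≤ℓ , ℓ<h+6+3nB     = progression-covering (h + 6) ℓ
      open Tripod G P h≤d d≤2h (dist⇒geodesic G cw) (progression-spaced 0 nA) (progression-spaced (h + 6) nB)
                  A≤d (All.zip (progression-≥ (h + 6) nB , B≤ℓ))
      nA+nB≤∣S∣ : nA + nB ≤ ∣ S ∣
      nA+nB≤∣S∣ = subst (_≤ ∣ S ∣) (cong₂ _+_ (length-progression 0 nA) (length-progression (h + 6) nB)) size
  in S , multipacking
       , ≤-trans (tripod-size-bound {h = h} {a = nA} {nB} r≤ℓ 2h≤1+d d<3nA ℓ<h+6+3nB) (+-monoˡ-≤ 9 (*-monoʳ-≤ 6 nA+nB≤∣S∣))

corollary6 : ∀ {n} (G : Graph n) (d r m : ℕ) → Connected G → IsDiameter G d → IsRadius G r → IsMultipackingNumber G m → d + 2 * r ≤ 6 * m + 9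
corollary6 G d r m connected (_ , _ , _ , diametral) (_ , not-within) (_ , maximal) =
  let S , S-multipacking , bound = large-multipacking G connected diametral not-within
  in ≤-trans bound (+-monoˡ-≤ 9 (*-monoʳ-≤ 6 (maximal S S-multipacking)))
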